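{- If $r$ is a BURD rotor type, then $UD(r)\equiv DU(r)\equiv r$.
   Context: A two-state rotor type is an infinite periodic sequence $r=(r^{(1)},r^{(2)},\dots)$ over $\{1,2\}$ with fundamental period $|r|$ (convention $r^{(1)}=1$); $r\equiv r'$ means one is obtained from the other by an injective relabeling of states. $r$ is balanced if $1$ and $2$ occur equally often in a period. A run is a contiguous block of consecutive positions; it is balanced if it contains equally many $1$'s and $2$'s, uniform if all its terms are equal. A balanced run decomposition (BRD) of a balanced $r$ is a partition of the period of $r$ into contiguous balanced runs; its type is the infinite periodic sequence $(b_1,b_2,\dots)$ where $2b_i$ is the length of the $i$-th run, $i$ taken modulo the number of runs. A uniform run decomposition (URD) of $r$ is a partition of the period of $r$ into contiguous uniform runs; its type is the infinite periodic sequence $(u_1,u_2,\dots)$ where $u_i$ is the length of the $i$-th run, $i$ taken modulo the number of runs. A BURD rotor type is a balanced rotor type that has a BRD and a URD of the same type. Rotor-router dynamics: at each non-target vertex $v$ there is a periodic sequence $e_v^{(1)},e_v^{(2)},\dots$ of out-edges; a particle starts at the source, on its $j$-th visit to $v$ leaves along $e_v^{(j)}$, and whenever it reaches a target it is returned to the source; the hitting sequence is the sequence of targets reached. The compressor for $r$ has non-target vertices $1$ (source), $2,3$ and targets $4,5$. On the $j$-th departure: from vertex $1$ the particle goes to vertex $2$ if $r^{(j)}=1$ and to vertex $3$ if $r^{(j)}=2$; from vertex $2$, in variant $U$ it goes to vertex $1$ if $r^{(j)}=1$ and to target $4$ if $r^{(j)}=2$, in variant $D$ to target $4$ if $r^{(j)}=1$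 and to vertex $1$ if $r^{(j)}=2$; from vertex $3$ likewise with target $5$. $UD(r)$ (resp. $DU(r)$) is the hitting sequence with variant $U$ at vertex $2$ and $D$ at $3$ (resp. $D$ at $2$, $U$ at $3$), viewed as a rotor type. -}

module Defs where

open import Data.Nat using (ℕ; zero; suc; _+_; _*_; _<_; _≤_)
open import Data.Nat.DivMod using (_mod_)
open import Data.List using (List; []; _∷_; length; lookup; map)
open import Data.Nat.ListAction using (sum)
open import Data.Maybe using (Maybe; just; nothing)
open import Data.Product using (Σ; ∃; ∃-syntax; _×_; _,_)
open import Data.Unit using (⊤)
open import Function.Definitions using (Injective)
open import Relation.Binary.PropositionalEquality using (_≡_)

-- Rotor types over the two states {1,2}.
-- A rotor type is a sequence r : ℕ → Two, where r n is r^{(n+1)} (0-indexed).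

data Two : Set where
  one two : Two

_==_ : Two → Two → ℕ
one == one = 1
two == two = 1
one == two = 0
two == one = 0

Periodic : (ℕ → Two) → ℕ → Set
Periodic r p = ∀ n → r (p + n) ≡ r n

FundamentalPeriod : (ℕ → Two) → ℕ → Set
FundamentalPeriod r p =
  (0 < p) × Periodic r p × (∀ q → 0 < q → Periodic r q → p ≤ q)

RotorType : (ℕ → Two) → ℕ → Set
RotorType r p = FundamentalPeriod r p × (r 0 ≡ one)

count : Two → (ℕ → Two) → ℕ → ℕ → ℕ
count c r s zero    = 0
count c r s (suc ℓ) = (r s == c) + count c r (suc s) ℓ

Balanced : (ℕ → Two) → ℕ → Set
Balanced r p = count one r 0 p ≡ count two r 0 p

BalancedRun : (ℕ → Two) → ℕ → ℕ → Set
BalancedRun r s ℓ = count one r s ℓ ≡ count two r s ℓ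

UniformRun : (ℕ → Two) → ℕ → ℕ → Set
UniformRun r s ℓ = ∀ i → i < ℓ → r (s + i) ≡ r s

Runs : (ℕ → ℕ → Set) → ℕ → List ℕ → Set
Runs P s []       = ⊤
Runs P s (ℓ ∷ ls) = (0 < ℓ) × P s ℓ × Runs P (s + ℓ) ls

Partition : (ℕ → ℕ → Set) → ℕ → List ℕ → Set
Partition P p ls = Runs P 0 ls × (sum ls ≡ p)

-- the infinite periodic sequence (x₁, x₂, …) with index taken modulo the
-- number of entries (0-indexed)
cyc : List ℕ → ℕ → ℕ
cyc []       i = 0
cyc (x ∷ xs) i = lookup (x ∷ xs) (i mod length (x ∷ xs))

-- bs is (the list of entries of) the type of a BRD of r: run lengths 2 b_i
IsBRD : (ℕ → Two) → ℕ → List ℕ → Set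
IsBRD r p bs = Partition (BalancedRun r) p (map (2 *_) bs)

-- us is (the list of entries of) the type of a URD of r: run lengths u_i
IsURD : (ℕ → Two) → ℕ → List ℕ → Set
IsURD r p us = Partition (UniformRun r) p us

BURD : (ℕ → Two) → ℕ → Set
BURD r p =
  RotorType r p × Balanced r p ×
  (∃[ bs ] ∃[ us ] (IsBRD r p bs × IsURD r p us × (∀ i → cyc bs i ≡ cyc us i)))

-- The compressor.  Non-target vertices v1 (source), v2, v3; targets t4, t5.

data Vtx : Set where
  v1 v2 v3 : Vtx

data Target : Set where
  t4 t5 : Target

data Dest : Set where
  node : Vtx → Dest
  tgt  : Target → Dest

data Variant : Set where
  U D : Variant

edgeVar : Variant → Target → Two → Dest
edgeVar U t one = node v1
edgeVar U t two = tgt t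
edgeVar D t one = tgt t
edgeVar D t two = node v1

-- e_v^{(j+1)} for the compressor with variants x2 at vertex 2 and x3 at vertex 3
edge : (ℕ → Two) → Variant → Variant → Vtx → ℕ → Dest
edge r x2 x3 v1 j with r j
... | one = node v2
... | two = node v3
edge r x2 x3 v2 j = edgeVar x2 t4 (r j)
edge r x2 x3 v3 j = edgeVar x3 t5 (r j)

-- state: current position and number of departures so far from each vertex
record State : Set where
  constructor st
  field
    pos : Vtx
    c1 c2 c3 : ℕ

record StepResult : Set where
  constructor res
  field
    next : State
    out  : Maybe Target

cnt : State → Vtx → ℕ
cnt (st _ a b c) v1 = a
cnt (st _ a b c) v2 = b
cnt (st _ a b c) v3 = c

bump : State → Vtx → Vtx → State
bump (st _ a b c) v1 w = st w (suc a) b c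
bump (st _ a b c) v2 w = st w a (suc b) c
bump (st _ a b c) v3 w = st w a b (suc c)

step : (ℕ → Two) → Variant → Variant → State → StepResult
step r x2 x3 s with edge r x2 x3 (State.pos s) (cnt s (State.pos s))
... | node w = res (bump s (State.pos s) w) nothing
... | tgt t  = res (bump s (State.pos s) v1) (just t)

initial : State
initial = st v1 0 0 0

stateAt : (ℕ → Two) → Variant → Variant → ℕ → State
stateAt r x2 x3 zero    = initial
stateAt r x2 x3 (suc n) = StepResult.next (step r x2 x3 (stateAt r x2 x3 n))

output : (ℕ → Two) → Variant → Variant → ℕ → Maybe Target
output r x2 x3 n = StepResult.out (step r x2 x3 (stateAt r x2 x3 n))

HittingSeq : (ℕ → Maybe Target) → (ℕ → Target) → Set
HittingSeq o h =
  Σ (ℕ → ℕ) λ t →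
    (∀ k → t k < t (suc k)) ×
    (∀ k → o (t k) ≡ just (h k)) ×
    (∀ n x → o n ≡ just x → ∃[ k ] t k ≡ n)

-- the hitting sequence of the compressor with variants (x2, x3) is
-- equivalent (injective relabeling of states) to r
HitEquiv : (ℕ → Two) → Variant → Variant → Set
HitEquiv r x2 x3 =
  Σ (ℕ → Target) λ h → HittingSeq (output r x2 x3) h ×
    (Σ (Target → Two) λ f → Injective _≡_ _≡_ f × (∀ k → f (h k) ≡ r k))

module Submission where

-- Between two visits to the source the particle makes exactly two moves, so
-- the a-th round trip reads r at position a (the source rotor) and then at
-- position count y r 0 a of the rotor of vertex 2 (y = 1) or 3 (y = 2).
-- Unrolling the BURD condition periodically splits ℕ into blocks j with
-- sizes b_j and S_j = b_0 + … + b_{j-1}: the source positions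
-- [2S_j, 2S_j + 2b_j) form a balanced run, so both counters of vertices 2
-- and 3 stay inside the uniform run [S_j, S_j + b_j) of some state c.
-- Within the block a round therefore hits a target exactly when the source
-- reads a state determined by c (b_j times, by balance), and the target
-- hit determines c.  Hence the hits with numbers S_j, …, S_j + b_j - 1 all
-- spell the state c = r_{S_j} = … = r_{S_j + b_j - 1}, up to relabeling.

open import Defs
open import Data.Nat using (ℕ; zero; suc; _+_; _*_; _<_; _≤_; z≤n; s≤s; z<s; _<?_; _%_)
open import Data.Nat.Properties
open import Data.Nat.DivMod using (_mod_; m%n<n; [m+n]%n≡m%n; m<n⇒m%n≡m)
open import Data.Fin using (Fin; toℕ)
open import Data.Fin.Properties using (toℕ-fromℕ<)
open import Data.List using (List; []; _∷_; length; lookup; map)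
open import Data.List.Properties using (map-id)
open import Data.Nat.ListAction using (sum)
open import Data.Maybe using (Maybe; just; nothing)
open import Data.Product using (∃-syntax; _×_; _,_; proj₁; proj₂; map₂)
open import Data.Sum using (_⊎_; inj₁; inj₂)
open import Data.Empty using (⊥-elim)
open import Relation.Nullary using (yes; no)
open import Relation.Binary using (tri<; tri≈; tri>)
open import Function using (_∘_)
open import Function.Definitions using (Injective)
open import Relation.Binary.PropositionalEquality
open ≡-Reasoning

prefixSum : (ℕ → ℕ) → ℕ → ℕ
prefixSum f zero    = 0
prefixSum f (suc j) = prefixSum f j + f j

prefixSum-suc : ∀ f j → prefixSum f (suc j) ≡ f 0 + prefixSum (f ∘ suc) j
prefixSum-suc f zero    = +-comm 0 (f 0)
prefixSum-suc f (suc j) =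
  trans (cong (_+ f (suc j)) (prefixSum-suc f j)) (+-assoc (f 0) _ _)

prefixSum-+ : ∀ f m j → prefixSum f (m + j) ≡ prefixSum f m + prefixSum (λ i → f (m + i)) j
prefixSum-+ f m zero    = trans (cong (prefixSum f) (+-identityʳ m)) (sym (+-identityʳ _))
prefixSum-+ f m (suc j) = trans (cong (prefixSum f) (+-suc m j))
  (trans (cong (_+ f (m + j)) (prefixSum-+ f m j)) (+-assoc (prefixSum f m) _ _))

prefixSum-cong : ∀ {f g} j → (∀ i → i < j → f i ≡ g i) → prefixSum f j ≡ prefixSum g j
prefixSum-cong zero    f≡g = refl
prefixSum-cong (suc j) f≡g =
  cong₂ _+_ (prefixSum-cong j (λ i i<j → f≡g i (m<n⇒m<1+n i<j))) (f≡g j ≤-refl)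

prefixSum-≥ : ∀ f → (∀ i → 0 < f i) → ∀ j → j ≤ prefixSum f j
prefixSum-≥ f f>0 zero    = z≤n
prefixSum-≥ f f>0 (suc j) =
  subst (_≤ prefixSum f j + f j) (+-comm j 1) (+-mono-≤ (prefixSum-≥ f f>0 j) (f>0 j))

prefixSum-cover : ∀ ℓ → (∀ j → 0 < ℓ j) →
  ∀ a → ∃[ j ] ∃[ d ] (a ≡ prefixSum ℓ j + d) × (d < ℓ j)
prefixSum-cover ℓ ℓ>0 zero = 0 , 0 , refl , ℓ>0 0
prefixSum-cover ℓ ℓ>0 (suc a) with prefixSum-cover ℓ ℓ>0 a
... | j , d , refl , d<ℓ with suc d <? ℓ j
...   | yes 1+d<ℓ = j , suc d , sym (+-suc _ d) , 1+d<ℓ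
...   | no  1+d≮ℓ = suc j , 0 , end-of-interval , ℓ>0 (suc j)
  where
  end-of-interval : suc (prefixSum ℓ j + d) ≡ prefixSum ℓ (suc j) + 0
  end-of-interval = begin
    suc (prefixSum ℓ j + d)  ≡⟨ sym (+-suc _ d) ⟩
    prefixSum ℓ j + suc d    ≡⟨ cong (prefixSum ℓ j +_) (≤-antisym d<ℓ (≮⇒≥ 1+d≮ℓ)) ⟩
    prefixSum ℓ (suc j)      ≡⟨ sym (+-identityʳ _) ⟩
    prefixSum ℓ (suc j) + 0  ∎

nth : List ℕ → ℕ → ℕ
nth []       i       = 0
nth (x ∷ xs) zero    = x
nth (x ∷ xs) (suc i) = nth xs i

lookup-nth : ∀ l (i : Fin (length l)) → lookup l i ≡ nth l (toℕ i)
lookup-nth (x ∷ xs) Fin.zero    = refl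
lookup-nth (x ∷ xs) (Fin.suc i) = lookup-nth xs i

cyc-nth : ∀ x xs j → cyc (x ∷ xs) j ≡ nth (x ∷ xs) (j % suc (length xs))
cyc-nth x xs j = trans (lookup-nth (x ∷ xs) (j mod suc (length xs)))
  (cong (nth (x ∷ xs)) (toℕ-fromℕ< (m%n<n j (suc (length xs)))))

prefixSum-nth : ∀ g l → prefixSum (g ∘ nth l) (length l) ≡ sum (map g l)
prefixSum-nth g []       = refl
prefixSum-nth g (x ∷ xs) =
  trans (prefixSum-suc (g ∘ nth (x ∷ xs)) (length xs)) (cong (g x +_) (prefixSum-nth g xs))

Runs-nth : ∀ (P : ℕ → ℕ → Set) g l s → Runs P s (map g l) →
  ∀ j → j < length l → (0 < g (nth l j)) × P (s + prefixSum (g ∘ nth l) j) (g (nth l j))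
Runs-nth P g (x ∷ xs) s (gx>0 , Px , runs) zero    _ = gx>0 , subst (λ u → P u (g x)) (sym (+-identityʳ s)) Px
Runs-nth P g (x ∷ xs) s (gx>0 , Px , runs) (suc j) (s≤s j<) =
  map₂ (subst (λ u → P u (g (nth xs j))) start≡) (Runs-nth P g xs (s + g x) runs j j<)
  where
  start≡ : s + g x + prefixSum (g ∘ nth xs) j ≡ s + prefixSum (g ∘ nth (x ∷ xs)) (suc j)
  start≡ = trans (+-assoc s (g x) _) (cong (s +_) (sym (prefixSum-suc (g ∘ nth (x ∷ xs)) j)))

module PeriodicExtension (P : ℕ → ℕ → Set) (p : ℕ) (P-shift : ∀ s ℓ → P s ℓ → P (p + s) ℓ)
    (g : ℕ → ℕ) (x : ℕ) (xs : List ℕ)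
    (runs : Runs P 0 (map g (x ∷ xs))) (total : sum (map g (x ∷ xs)) ≡ p) where

  private
    n : ℕ
    n = length (x ∷ xs)

    ℓ : ℕ → ℕ
    ℓ = g ∘ cyc (x ∷ xs)

    ℓ-periodic : ∀ j → ℓ (n + j) ≡ ℓ j
    ℓ-periodic j = cong g (begin
      cyc (x ∷ xs) (n + j)         ≡⟨ cyc-nth x xs (n + j) ⟩
      nth (x ∷ xs) ((n + j) % n)   ≡⟨ cong (λ i → nth (x ∷ xs) (i % n)) (+-comm n j) ⟩
      nth (x ∷ xs) ((j + n) % n)   ≡⟨ cong (nth (x ∷ xs)) ([m+n]%n≡m%n j n) ⟩
      nth (x ∷ xs) (j % n)         ≡⟨ cyc-nth x xs j ⟨
      cyc (x ∷ xs) j               ∎)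

    ℓ-first-period : ∀ j → j < n → ℓ j ≡ g (nth (x ∷ xs) j)
    ℓ-first-period j j<n = cong g (trans (cyc-nth x xs j) (cong (nth (x ∷ xs)) (m<n⇒m%n≡m j<n)))

    prefixSum-periodic : ∀ j → prefixSum ℓ (n + j) ≡ p + prefixSum ℓ j
    prefixSum-periodic j = begin
      prefixSum ℓ (n + j)                                     ≡⟨ prefixSum-+ ℓ n j ⟩
      prefixSum ℓ n + prefixSum (λ i → ℓ (n + i)) j           ≡⟨ cong₂ _+_ first-period (prefixSum-cong j (λ i _ → ℓ-periodic i)) ⟩
      p + prefixSum ℓ j                                       ∎
      where
      first-period : prefixSum ℓ n ≡ p
      first-period = trans (prefixSum-cong n ℓ-first-period) (trans (prefixSum-nth g (x ∷ xs)) total)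

    Good : ℕ → Set
    Good j = (0 < ℓ j) × P (prefixSum ℓ j) (ℓ j)

    good-first-period : ∀ j → j < n → Good j
    good-first-period j j<n =
      subst₂ (λ u v → (0 < v) × P u v)
        (prefixSum-cong j (λ i i<j → sym (ℓ-first-period i (<-trans i<j j<n))))
        (sym (ℓ-first-period j j<n))
        (Runs-nth P g (x ∷ xs) 0 runs j j<n)

    good-next-period : ∀ j → Good j → Good (n + j)
    good-next-period j (ℓ>0 , Pj) =
      subst₂ (λ u v → (0 < v) × P u v) (sym (prefixSum-periodic j)) (sym (ℓ-periodic j))
        (ℓ>0 , P-shift _ _ Pj)

    good-below : ∀ bound j → j < bound → Good j
    good-below (suc bound) j j≤bound with j <? n
    ... | yes j<n = good-first-period j j<n
    ... | no  j≮n with m≤n⇒∃[o]m+o≡n (≮⇒≥ j≮n)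
    ...   | j′ , refl =
      good-next-period j′ (good-below bound j′ (≤-trans (s≤s (m≤n+m j′ (length xs))) (≤-pred j≤bound)))

  extended-runs : ∀ j → (0 < g (cyc (x ∷ xs) j)) × P (prefixSum (g ∘ cyc (x ∷ xs)) j) (g (cyc (x ∷ xs) j))
  extended-runs j = good-below (suc j) j ≤-refl

==-refl : ∀ y → (y == y) ≡ 1
==-refl one = refl
==-refl two = refl

==⇒≡ : ∀ {y c} → (y == c) ≡ 1 → y ≡ c
==⇒≡ {one} {one} _ = refl
==⇒≡ {two} {two} _ = refl

count-+ : ∀ c r s x y → count c r s (x + y) ≡ count c r s x + count c r (s + x) y
count-+ c r s zero    y = cong (λ u → count c r u y) (sym (+-identityʳ s))
count-+ c r s (suc x) y = begin
  (r s == c) + count c r (suc s) (x + y)                              ≡⟨ cong ((r s == c) +_) (count-+ c r (suc s) x y) ⟩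
  (r s == c) + (count c r (suc s) x + count c r (suc s + x) y)        ≡⟨ +-assoc (r s == c) _ _ ⟨
  (r s == c) + count c r (suc s) x + count c r (suc s + x) y          ≡⟨ cong (λ u → (r s == c) + count c r (suc s) x + count c r u y) (sym (+-suc s x)) ⟩
  (r s == c) + count c r (suc s) x + count c r (s + suc x) y          ∎

count-suc : ∀ c r s x → count c r s (suc x) ≡ count c r s x + (r (s + x) == c)
count-suc c r s x = begin
  count c r s (suc x)                   ≡⟨ cong (count c r s) (+-comm 1 x) ⟩
  count c r s (x + 1)                   ≡⟨ count-+ c r s x 1 ⟩
  count c r s x + ((r (s + x) == c) + 0) ≡⟨ cong (count c r s x +_) (+-identityʳ _) ⟩
  count c r s x + (r (s + x) == c)      ∎

count-one+two : ∀ r s ℓ → count one r s ℓ + count two r s ℓ ≡ ℓ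
count-one+two r s zero = refl
count-one+two r s (suc ℓ) with r s
... | one = cong suc (count-one+two r (suc s) ℓ)
... | two = trans (+-suc _ _) (cong suc (count-one+two r (suc s) ℓ))

count-periodic : ∀ {r p} → Periodic r p → ∀ c s ℓ → count c r (p + s) ℓ ≡ count c r s ℓ
count-periodic per c s zero    = refl
count-periodic {r} {p} per c s (suc ℓ) = cong₂ _+_ (cong (_== c) (per s))
  (trans (cong (λ u → count c r u ℓ) (sym (+-suc p s))) (count-periodic per c (suc s) ℓ))

count-balanced : ∀ r s b → BalancedRun r s (2 * b) → ∀ y → count y r s (2 * b) ≡ b
count-balanced r s b balanced one = *-cancelˡ-≡ _ b 2 (begin
  2 * count one r s (2 * b)                     ≡⟨ cong (count one r s (2 * b) +_) (+-identityʳ _) ⟩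
  count one r s (2 * b) + count one r s (2 * b) ≡⟨ cong (count one r s (2 * b) +_) balanced ⟩
  count one r s (2 * b) + count two r s (2 * b) ≡⟨ count-one+two r s (2 * b) ⟩
  2 * b                                         ∎)
count-balanced r s b balanced two = trans (sym balanced) (count-balanced r s b balanced one)

count-<-at : ∀ y r s d ℓ → d < ℓ → r (s + d) ≡ y → count y r s d < count y r s ℓ
count-<-at y r s d ℓ d<ℓ occurs with m≤n⇒∃[o]m+o≡n d<ℓ
... | e , refl = <-≤-trans up-to-d up-to-ℓ
  where
  hit : (r (s + d) == y) ≡ 1
  hit = trans (cong (_== y) occurs) (==-refl y)
  up-to-d : count y r s d < count y r s (suc d)
  up-to-d = subst (count y r s d <_) (sym (count-suc y r s d)) (m<m+n _ (subst (0 <_) (sym hit) z<s))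
  up-to-ℓ : count y r s (suc d) ≤ count y r s (suc d + e)
  up-to-ℓ = subst (count y r s (suc d) ≤_) (sym (count-+ y r s (suc d) e)) (m≤m+n _ _)

record Blocks (r : ℕ → Two) : Set where
  field
    size          : ℕ → ℕ
    size-positive : ∀ j → 0 < size j
    balanced      : ∀ j → BalancedRun r (prefixSum (λ i → 2 * size i) j) (2 * size j)
    uniform       : ∀ j → UniformRun r (prefixSum size j) (size j)

BURD⇒Blocks : ∀ r p → BURD r p → Blocks r
BURD⇒Blocks r p (((p>0 , per , _) , _) , _ , bs , us , (brd , brd-total) , (urd , urd-total) , bs≡us) =
  blocks bs us brd brd-total urd urd-total bs≡us
  where
  shift-balanced : ∀ s ℓ → BalancedRun r s ℓ → BalancedRun r (p + s) ℓ
  shift-balanced s ℓ bal =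
    trans (count-periodic per one s ℓ) (trans bal (sym (count-periodic per two s ℓ)))

  shift-uniform : ∀ s ℓ → UniformRun r s ℓ → UniformRun r (p + s) ℓ
  shift-uniform s ℓ uni i i<ℓ =
    trans (cong r (+-assoc p s i)) (trans (per (s + i)) (trans (uni i i<ℓ) (sym (per s))))

  blocks : ∀ bs us → Runs (BalancedRun r) 0 (map (2 *_) bs) → sum (map (2 *_) bs) ≡ p →
           Runs (UniformRun r) 0 us → sum us ≡ p → (∀ i → cyc bs i ≡ cyc us i) → Blocks r
  blocks []       us       brd brd-total urd urd-total bs≡us = ⊥-elim (<-irrefl brd-total p>0)
  blocks (b ∷ bs) []       brd brd-total urd urd-total bs≡us = ⊥-elim (<-irrefl urd-total p>0)
  blocks (b ∷ bs) (u ∷ us) brd brd-total urd urd-total bs≡us = record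
    { size          = cyc (b ∷ bs)
    ; size-positive = λ j → subst (0 <_) (sym (bs≡us j)) (proj₁ (U.extended-runs j))
    ; balanced      = λ j → proj₂ (B.extended-runs j)
    ; uniform       = λ j → subst₂ (UniformRun r) (prefixSum-cong j (λ i _ → sym (bs≡us i))) (sym (bs≡us j))
                                (proj₂ (U.extended-runs j))
    }
    where
    module B = PeriodicExtension (BalancedRun r) p shift-balanced (2 *_) b bs brd brd-total
    module U = PeriodicExtension (UniformRun r) p shift-uniform (λ u → u) u us
      (subst (Runs (UniformRun r) 0) (sym (map-id (u ∷ us))) urd)
      (trans (cong sum (map-id (u ∷ us))) urd-total)

double : ℕ → ℕ
double zero    = 0
double (suc a) = suc (suc (double a))

double-mono-< : ∀ {a b} → a < b → double a < double b
double-mono-< {zero}  {suc b} _          = s≤s z≤n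
double-mono-< {suc a} {suc b} (s≤s a<b) = s≤s (s≤s (double-mono-< a<b))

even-or-odd : ∀ n → ∃[ a ] (n ≡ double a ⊎ n ≡ suc (double a))
even-or-odd zero = 0 , inj₁ refl
even-or-odd (suc n) with even-or-odd n
... | a , inj₁ refl = a , inj₂ refl
... | a , inj₂ refl = suc a , inj₁ refl

hitFrom : Variant → Target → Two → Maybe Target
hitFrom U t one = nothing
hitFrom U t two = just t
hitFrom D t one = just t
hitFrom D t two = nothing

-- The outcome of a round trip whose source rotor reads y while the rotors of
-- vertices 2 and 3 read c₂ and c₃.
roundOutcome : Variant → Variant → Two → Two → Two → Maybe Target
roundOutcome x2 x3 one c₂ c₃ = hitFrom x2 t4 c₂
roundOutcome x2 x3 two c₂ c₃ = hitFrom x3 t5 c₃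

roundOutput : (ℕ → Two) → Variant → Variant → ℕ → Maybe Target
roundOutput r x2 x3 a = roundOutcome x2 x3 (r a) (r (count one r 0 a)) (r (count two r 0 a))

afterRound : Two → ℕ → ℕ → ℕ → State
afterRound one a b c = st v1 (suc a) (suc b) c
afterRound two a b c = st v1 (suc a) b (suc c)

move : (ℕ → Two) → Variant → Variant → State → State
move r x2 x3 = StepResult.next ∘ step r x2 x3

moveOutput : (ℕ → Two) → Variant → Variant → State → Maybe Target
moveOutput r x2 x3 = StepResult.out ∘ step r x2 x3

round-state : ∀ r x2 x3 a b c → move r x2 x3 (move r x2 x3 (st v1 a b c)) ≡ afterRound (r a) a b c
round-state r x2 x3 a b c with r a
round-state r U x3 a b c | one with r b
... | one = refl
... | two = refl
round-state r D x3 a b c | one with r b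
... | one = refl
... | two = refl
round-state r x2 U a b c | two with r c
... | one = refl
... | two = refl
round-state r x2 D a b c | two with r c
... | one = refl
... | two = refl

round-first-output : ∀ r x2 x3 a b c → moveOutput r x2 x3 (st v1 a b c) ≡ nothing
round-first-output r x2 x3 a b c with r a
... | one = refl
... | two = refl

round-second-output : ∀ r x2 x3 a b c →
  moveOutput r x2 x3 (move r x2 x3 (st v1 a b c)) ≡ roundOutcome x2 x3 (r a) (r b) (r c)
round-second-output r x2 x3 a b c with r a
round-second-output r U x3 a b c | one with r b
... | one = refl
... | two = refl
round-second-output r D x3 a b c | one with r b
... | one = refl
... | two = refl
round-second-output r x2 U a b c | two with r c
... | one = refl
... | two = refl
round-second-output r x2 D a b c | two with r c
... | one = refl
... | two = refl

afterRound-counts : ∀ r a → afterRound (r a) a (count one r 0 a) (count two r 0 a)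
                          ≡ st v1 (suc a) (count one r 0 (suc a)) (count two r 0 (suc a))
afterRound-counts r a rewrite count-suc one r 0 a | count-suc two r 0 a with r a
... | one = cong₂ (st v1 (suc a)) (+-comm 1 _) (sym (+-identityʳ _))
... | two = cong₂ (st v1 (suc a)) (sym (+-identityʳ _)) (+-comm 1 _)

stateAt-double : ∀ r x2 x3 a → stateAt r x2 x3 (double a) ≡ st v1 a (count one r 0 a) (count two r 0 a)
stateAt-double r x2 x3 zero = refl
stateAt-double r x2 x3 (suc a) rewrite stateAt-double r x2 x3 a =
  trans (round-state r x2 x3 a _ _) (afterRound-counts r a)

output-even : ∀ r x2 x3 a → output r x2 x3 (double a) ≡ nothing
output-even r x2 x3 a rewrite stateAt-double r x2 x3 a = round-first-output r x2 x3 a _ _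

output-odd : ∀ r x2 x3 a → output r x2 x3 (suc (double a)) ≡ roundOutput r x2 x3 a
output-odd r x2 x3 a rewrite stateAt-double r x2 x3 a = round-second-output r x2 x3 a _ _

emitted : {A : Set} → Maybe A → ℕ
emitted (just _) = 1
emitted nothing  = 0

emissionsBefore : {A : Set} → (ℕ → Maybe A) → ℕ → ℕ
emissionsBefore E zero    = 0
emissionsBefore E (suc a) = emissionsBefore E a + emitted (E a)

record Emission {A : Set} (E : ℕ → Maybe A) (k : ℕ) : Set where
  field
    time  : ℕ
    value : A
    emits : E time ≡ just value
    index : emissionsBefore E time ≡ k

module _ {A : Set} (E : ℕ → Maybe A) where

  emissionsBefore-mono : ∀ {a b} → a ≤ b → emissionsBefore E a ≤ emissionsBefore E b
  emissionsBefore-mono {b = zero}  z≤n = ≤-refl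
  emissionsBefore-mono {b = suc b} a≤1+b with m≤n⇒m<n∨m≡n a≤1+b
  ... | inj₁ a<1+b = ≤-trans (emissionsBefore-mono (≤-pred a<1+b)) (m≤m+n _ _)
  ... | inj₂ refl  = ≤-refl

  emissionsBefore-strict : ∀ {a b x} → E a ≡ just x → a < b → emissionsBefore E a < emissionsBefore E b
  emissionsBefore-strict {a} {b} Ea a<b =
    subst (_≤ emissionsBefore E b) (trans (cong (λ e → emissionsBefore E a + emitted e) Ea) (+-comm _ 1))
      (emissionsBefore-mono a<b)

  emission-below : ∀ k a → k < emissionsBefore E a → Emission E k
  emission-below k (suc a) k< with k <? emissionsBefore E a
  ... | yes k<Ca = emission-below k a k<Ca
  ... | no  k≮Ca with E a in Ea
  ...   | nothing = ⊥-elim (k≮Ca (subst (k <_) (+-identityʳ _) k<))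
  ...   | just x  = record
    { time = a ; value = x ; emits = Ea
    ; index = ≤-antisym (≮⇒≥ k≮Ca) (≤-pred (subst (k <_) (+-comm _ 1) k<)) }

module Enumeration {A : Set} (E : ℕ → Maybe A)
    (unbounded : ∀ k → ∃[ a ] k < emissionsBefore E a) where
  open Emission public

  emission : ∀ k → Emission E k
  emission k = emission-below E k (proj₁ (unbounded k)) (proj₂ (unbounded k))

  time-increasing : ∀ k → time (emission k) < time (emission (suc k))
  time-increasing k = ≰⇒> λ later≤ →
    1+n≰n (subst₂ _≤_ (index (emission (suc k))) (index (emission k)) (emissionsBefore-mono E later≤))

  time-onto : ∀ {a x} → E a ≡ just x → time (emission (emissionsBefore E a)) ≡ a
  time-onto {a} Ea with <-cmp (time (emission (emissionsBefore E a))) a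
  ... | tri≈ _ t≡a _ = t≡a
  ... | tri< t<a _ _ = ⊥-elim (<-irrefl (index e) (emissionsBefore-strict E (emits e) t<a))
    where e = emission (emissionsBefore E a)
  ... | tri> _ _ a<t = ⊥-elim (<-irrefl (sym (index e)) (emissionsBefore-strict E Ea a<t))
    where e = emission (emissionsBefore E a)

hitEquiv : ∀ r x2 x3 (f : Target → Two) → Injective _≡_ _≡_ f →
  (∀ k → ∃[ a ] k < emissionsBefore (roundOutput r x2 x3) a) →
  (∀ a x → roundOutput r x2 x3 a ≡ just x → f x ≡ r (emissionsBefore (roundOutput r x2 x3) a)) →
  HitEquiv r x2 x3
hitEquiv r x2 x3 f f-injective unbounded f-correct =
  hit , (hitTime , hitTime-increasing , hitTime-output , only-hits) , f , f-injective , f-hit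
  where
  open Enumeration (roundOutput r x2 x3) unbounded

  hit : ℕ → Target
  hit k = value (emission k)

  hitTime : ℕ → ℕ
  hitTime k = suc (double (time (emission k)))

  hitTime-increasing : ∀ k → hitTime k < hitTime (suc k)
  hitTime-increasing k = s≤s (double-mono-< (time-increasing k))

  hitTime-output : ∀ k → output r x2 x3 (hitTime k) ≡ just (hit k)
  hitTime-output k = trans (output-odd r x2 x3 _) (emits (emission k))

  only-hits : ∀ n x → output r x2 x3 n ≡ just x → ∃[ k ] hitTime k ≡ n
  only-hits n x out with even-or-odd n
  ... | a , inj₁ refl with trans (sym out) (output-even r x2 x3 a)
  ...   | ()
  only-hits n x out | a , inj₂ refl =
    emissionsBefore (roundOutput r x2 x3) a ,
    cong (suc ∘ double) (time-onto (trans (sym (output-odd r x2 x3 a)) out))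

  f-hit : ∀ k → f (hit k) ≡ r k
  f-hit k = trans (f-correct _ _ (emits (emission k))) (cong r (index (emission k)))

-- How a compressor variant behaves once the rotors of vertices 2 and 3 both
-- read the same state c: it hits a target exactly when the source reads
-- emitter c, and that target determines c.
record Compressing (x2 x3 : Variant) : Set where
  field
    emitter         : Two → Two
    label           : Target → Two
    label-injective : Injective _≡_ _≡_ label
    emits-iff       : ∀ y c → emitted (roundOutcome x2 x3 y c c) ≡ (y == emitter c)
    emits-label     : ∀ y c x → roundOutcome x2 x3 y c c ≡ just x → label x ≡ c

  emits-emitter : ∀ {y c x} → roundOutcome x2 x3 y c c ≡ just x → y ≡ emitter c
  emits-emitter {y} {c} hit = ==⇒≡ (trans (sym (emits-iff y c)) (cong emitted hit))

module BlockAnalysis (r : ℕ → Two) (B : Blocks r) {x2 x3 : Variant} (K : Compressing x2 x3) where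
  open Blocks B
  open Compressing K

  private
    E : ℕ → Maybe Target
    E = roundOutput r x2 x3

    C : ℕ → ℕ
    C = emissionsBefore E

    S : ℕ → ℕ
    S = prefixSum size

    start : ℕ → ℕ
    start = prefixSum (λ i → 2 * size i)

  roundOutput-reading : ∀ a {y c} → r a ≡ y → r (count y r 0 a) ≡ c → E a ≡ roundOutcome x2 x3 y c c
  roundOutput-reading a {one} ra rc rewrite ra | rc = refl
  roundOutput-reading a {two} ra rc rewrite ra | rc = refl

  module InBlock (j : ℕ) (counts : ∀ y → count y r 0 (start j) ≡ S j) (emissions : C (start j) ≡ S j) where
    c : Two
    c = r (S j)

    block-count : ∀ y → count y r (start j) (2 * size j) ≡ size j
    block-count = count-balanced r (start j) (size j) (balanced j)

    count-within : ∀ y d → count y r 0 (start j + d) ≡ S j + count y r (start j) d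
    count-within y d = trans (count-+ y r 0 (start j) d) (cong (_+ count y r (start j) d) (counts y))

    counter-within : ∀ {d y} → d < 2 * size j → r (start j + d) ≡ y → count y r (start j) d < size j
    counter-within {d} {y} d< occurs =
      subst (count y r (start j) d <_) (block-count y) (count-<-at y r (start j) d (2 * size j) d< occurs)

    output-within : ∀ {d} → d < 2 * size j → E (start j + d) ≡ roundOutcome x2 x3 (r (start j + d)) c c
    output-within {d} d< = roundOutput-reading _ refl
      (trans (cong r (count-within _ d)) (uniform j _ (counter-within d< refl)))

    emissions-within : ∀ d → d ≤ 2 * size j → C (start j + d) ≡ S j + count (emitter c) r (start j) d
    emissions-within zero    _  = trans (cong C (+-identityʳ (start j))) (trans emissions (sym (+-identityʳ (S j))))
    emissions-within (suc d) d< = begin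
      C (start j + suc d)                                          ≡⟨ cong C (+-suc (start j) d) ⟩
      C (start j + d) + emitted (E (start j + d))                  ≡⟨ cong₂ _+_ (emissions-within d (<⇒≤ d<))
                                                                              (cong emitted (output-within d<)) ⟩
      S j + count s r (start j) d
        + emitted (roundOutcome x2 x3 (r (start j + d)) c c)      ≡⟨ cong (S j + count s r (start j) d +_) (emits-iff _ c) ⟩
      S j + count s r (start j) d + (r (start j + d) == s)        ≡⟨ +-assoc (S j) _ _ ⟩
      S j + (count s r (start j) d + (r (start j + d) == s))      ≡⟨ cong (S j +_) (count-suc s r (start j) d) ⟨
      S j + count s r (start j) (suc d)                            ∎
      where s = emitter c

    label-within : ∀ {d x} → d < 2 * size j → E (start j + d) ≡ just x → label x ≡ r (C (start j + d))
    label-within {d} {x} d< Ex = begin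
      label x                                      ≡⟨ emits-label (r (start j + d)) c x outcome ⟩
      c                                            ≡⟨ uniform j (count (emitter c) r (start j) d) (counter-within d< (emits-emitter outcome)) ⟨
      r (S j + count (emitter c) r (start j) d)    ≡⟨ cong r (emissions-within d (<⇒≤ d<)) ⟨
      r (C (start j + d))                          ∎
      where
      outcome : roundOutcome x2 x3 (r (start j + d)) c c ≡ just x
      outcome = trans (sym (output-within d<)) Ex

    counts-at-end : ∀ y → count y r 0 (start (suc j)) ≡ S (suc j)
    counts-at-end y = trans (count-within y (2 * size j)) (cong (S j +_) (block-count y))

    emissions-at-end : C (start (suc j)) ≡ S (suc j)
    emissions-at-end =
      trans (emissions-within (2 * size j) ≤-refl) (cong (S j +_) (block-count (emitter c)))

  block-boundary : ∀ j → (∀ y → count y r 0 (start j) ≡ S j) × (C (start j) ≡ S j)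
  block-boundary zero    = (λ _ → refl) , refl
  block-boundary (suc j) = counts-at-end , emissions-at-end
    where open InBlock j (proj₁ (block-boundary j)) (proj₂ (block-boundary j))

  emission-label : ∀ a x → E a ≡ just x → label x ≡ r (C a)
  emission-label a x Ea with prefixSum-cover (λ i → 2 * size i) (λ j → *-monoʳ-< 2 (size-positive j)) a
  ... | j , d , refl , d< = InBlock.label-within j (proj₁ (block-boundary j)) (proj₂ (block-boundary j)) d< Ea

  emissions-unbounded : ∀ k → ∃[ a ] k < C a
  emissions-unbounded k =
    start (suc k) , subst (k <_) (sym (proj₂ (block-boundary (suc k)))) (prefixSum-≥ size size-positive (suc k))

Blocks⇒HitEquiv : ∀ {x2 x3} → Compressing x2 x3 → ∀ r → Blocks r → HitEquiv r x2 x3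
Blocks⇒HitEquiv K r B = hitEquiv r _ _ label label-injective emissions-unbounded emission-label
  where
  open Compressing K
  open BlockAnalysis r B K

other : Two → Two
other one = two
other two = one

compressing-UD : Compressing U D
compressing-UD = record
  { emitter = other ; label = label ; label-injective = label-injective
  ; emits-iff = emits-iff ; emits-label = emits-label }
  where
  label : Target → Two
  label t4 = two
  label t5 = one

  label-injective : Injective _≡_ _≡_ label
  label-injective {t4} {t4} _ = refl
  label-injective {t5} {t5} _ = refl

  emits-iff : ∀ y c → emitted (roundOutcome U D y c c) ≡ (y == other c)
  emits-iff one one = refl
  emits-iff one two = refl
  emits-iff two one = refl
  emits-iff two two = refl

  emits-label : ∀ y c x → roundOutcome U D y c c ≡ just x → label x ≡ c
  emits-label one two t4 refl = refl
  emits-label two one t5 refl = refl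

compressing-DU : Compressing D U
compressing-DU = record
  { emitter = λ c → c ; label = label ; label-injective = label-injective
  ; emits-iff = emits-iff ; emits-label = emits-label }
  where
  label : Target → Two
  label t4 = one
  label t5 = two

  label-injective : Injective _≡_ _≡_ label
  label-injective {t4} {t4} _ = refl
  label-injective {t5} {t5} _ = refl

  emits-iff : ∀ y c → emitted (roundOutcome D U y c c) ≡ (y == c)
  emits-iff one one = refl
  emits-iff one two = refl
  emits-iff two one = refl
  emits-iff two two = refl

  emits-label : ∀ y c x → roundOutcome D U y c c ≡ just x → label x ≡ c
  emits-label one one t4 refl = refl
  emits-label two two t5 refl = refl

theorem7p11 : (r : ℕ → Two) (p : ℕ) → BURD r p →
    HitEquiv r U D × HitEquiv r D U
theorem7p11 r p burd = Blocks⇒HitEquiv compressing-UD r blocks , Blocks⇒HitEquiv compressing-DU r blocks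
  where
  blocks : Blocks r
  blocks = BURD⇒Blocks r p burd
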